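{- Let $S$ be as in the context. For $1\le i\le n-1$, $$\overline1+\overline2+\cdots+\overline i=\begin{cases}\widetilde s_i+\widetilde s_n, & \text{if } |[\overline i]\cap\Pi_1| \text{ is odd};\\ \widetilde s_i, & \text{if } |[\overline i]\cap\Pi_1| \text{ is even},\end{cases}$$ and $$\overline1+\overline2+\cdots+\overline n=\begin{cases}\widetilde s_n, & \text{if } |\Pi_1| \text{ is odd};\\ 0, & \text{if } |\Pi_1| \text{ is even}.\end{cases}$$
   Context: $S$ is a finite simple connected graph with vertex set $\{s_1,\dots,s_n\}$, $n\ge2$, and edge set $R$, such that $s_1,\dots,s_{n-1}$ is an induced path; $s_n$ is adjacent to some of $s_1,\dots,s_{n-1}$. $\widetilde s$ is the characteristic vector in $F_2^n$ (coordinates indexed by vertices) of vertex $s$. The flipping move of $s$ is $\mathbf s\in\mathrm{Mat}_n(F_2)$ with $\mathbf s_{ab}=1$ if $a=b$, or if $b=s$ and $ab\in R$, and $0$ otherwise. $\overline1=\widetilde s_1$ and $\overline{i+1}=\mathbf{s_i}\cdots\mathbf{s_1}\overline1$ for $1\le i\le n-1$. $\Pi=\{\overline1,\dots,\overline n\}$, $\Pi_0=\{\overline i\in\Pi:\langle\overline i,\widetilde s_n\rangle=0\}$ (dot product over $F_2$), $\Pi_1=\Pi\setminus\Pi_0$, and $[\overline i]=\{\overline1,\dots,\overline i\}$. -}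

module Defs where

open import Data.Bool using (Bool; true; false; _∧_; _∨_; _xor_; if_then_else_)
open import Data.Nat using (ℕ; zero; suc; _+_; _≤_; _<_; s≤s; z≤n)
open import Data.Nat.Properties using (≤-pred)
open import Data.Fin using (Fin; zero; suc; toℕ; fromℕ; fromℕ<; inject₁)
open import Data.Fin.Properties using (toℕ≤pred[n])
open import Data.Sum using (_⊎_)
open import Data.Empty using (⊥)
open import Relation.Binary.PropositionalEquality using (_≡_)
open import Relation.Nullary using (¬_)
open import Relation.Nullary.Decidable using (⌊_⌋)
import Data.Fin as F

-- Vectors over F₂ (Bool with xor as addition, ∧ as multiplication),
-- given as functions on the index set.

VecF2 : ℕ → Set
VecF2 n = Fin n → Bool

_≋_ : ∀ {n} → VecF2 n → VecF2 n → Set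
u ≋ v = ∀ a → u a ≡ v a

zeroV : ∀ {n} → VecF2 n
zeroV _ = false

_⊕_ : ∀ {n} → VecF2 n → VecF2 n → VecF2 n
(u ⊕ v) a = u a xor v a

ΣF2 : ∀ {n} → (Fin n → Bool) → Bool
ΣF2 {zero}  f = false
ΣF2 {suc n} f = f zero xor ΣF2 (λ i → f (suc i))

ΣV : ∀ {m n} → (Fin m → VecF2 n) → VecF2 n
ΣV f a = ΣF2 (λ i → f i a)

⟨_,_⟩ : ∀ {n} → VecF2 n → VecF2 n → Bool
⟨ u , v ⟩ = ΣF2 (λ a → u a ∧ v a)

chi : ∀ {n} → Fin n → VecF2 n
chi s a = ⌊ a F.≟ s ⌋

count : ∀ {n} → (Fin n → Bool) → ℕ
count {zero}  p = 0
count {suc n} p = (if p zero then 1 else 0) + count (λ i → p (suc i))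

Mat : ℕ → Set
Mat n = Fin n → Fin n → Bool

_·_ : ∀ {n} → Mat n → VecF2 n → VecF2 n
(M · v) a = ΣF2 (λ b → M a b ∧ v b)

Adj : ℕ → Set
Adj n = Fin n → Fin n → Bool

Simple : ∀ {n} → Adj n → Set
Simple {n} R = (∀ a b → R a b ≡ R b a) × (∀ a → R a a ≡ false)
  where open import Data.Product using (_×_)

data Reach {n} (R : Adj n) : Fin n → Fin n → Set where
  here : ∀ {a} → Reach R a a
  step : ∀ {a b c} → R a b ≡ true → Reach R b c → Reach R a c

Connected : ∀ {n} → Adj n → Set
Connected {n} R = ∀ a b → Reach R a b

-- Graph on n = suc k vertices s₁,…,s_{n} (here Fin (suc k)); the path
-- vertices s₁,…,s_{n-1} are inject₁ i for i : Fin k, and sₙ is fromℕ k.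
-- s₁,…,s_{n-1} is an induced path: two path vertices are adjacent iff
-- their indices differ by exactly one.
InducedPath : ∀ {k} → Adj (suc k) → Set
InducedPath {k} R = ∀ (i j : Fin k) →
  (R (inject₁ i) (inject₁ j) ≡ true → (toℕ j ≡ suc (toℕ i)) ⊎ (toℕ i ≡ suc (toℕ j))) ×
  ((toℕ j ≡ suc (toℕ i)) ⊎ (toℕ i ≡ suc (toℕ j)) → R (inject₁ i) (inject₁ j) ≡ true)
  where open import Data.Product using (_×_)

flipMat : ∀ {n} → Adj n → Fin n → Mat n
flipMat R s a b = ⌊ a F.≟ b ⌋ ∨ (⌊ b F.≟ s ⌋ ∧ R a b)

pathV : ∀ {k} → Fin k → Fin (suc k)
pathV = inject₁

-- flips j p v = 𝐬_j ⋯ 𝐬_1 v  (apply 𝐬₁ first), for j ≤ k = n-1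
flips : ∀ {k} → Adj (suc k) → (j : ℕ) → j ≤ k → VecF2 (suc k) → VecF2 (suc k)
flips R zero    _ v = v
flips R (suc j) p v = flipMat R (pathV (fromℕ< p)) · flips R j (≤-pred (Data.Nat.Properties.≤-trans (Data.Nat.Properties.n≤1+n (suc j)) (s≤s p))) v
  where import Data.Nat.Properties

-- The vectors  ī  (0-indexed: bar i = \overline{toℕ i + 1}):
--   \overline{1} = s̃₁,  \overline{i+1} = 𝐬_i ⋯ 𝐬_1 \overline{1}.
bar : ∀ {k} → Adj (suc k) → Fin (suc k) → VecF2 (suc k)
bar {k} R i = flips R (toℕ i) (toℕ≤pred[n] i) (chi (pathV0 k))
  where
  pathV0 : (k : ℕ) → Fin (suc k)
  pathV0 k = zero   -- s₁ is vertex 0 (for k = 0 this would be sₙ, but n ≥ 2 is assumed)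

lastV : ∀ k → Fin (suc k)
lastV k = fromℕ k

-- membership of ī in Π₁ : ⟨ ī , s̃ₙ ⟩ = 1
inΠ₁ : ∀ {k} → Adj (suc k) → Fin (suc k) → Bool
inΠ₁ {k} R i = ⟨ bar R i , chi (lastV k) ⟩

-- |[ī] ∩ Π₁| (0-indexed i), counted over indices j ≤ i
countPrefΠ₁ : ∀ {k} → Adj (suc k) → Fin (suc k) → ℕ
countPrefΠ₁ R i = count (λ j → ⌊ toℕ j Data.Nat.≤? toℕ i ⌋ ∧ inΠ₁ R j)
  where import Data.Nat

countΠ₁ : ∀ {k} → Adj (suc k) → ℕ
countΠ₁ R = count (inΠ₁ R)

-- \overline1 + ⋯ + \overline i  (0-indexed i: sum over j ≤ i)
prefSum : ∀ {k} → Adj (suc k) → Fin (suc k) → VecF2 (suc k)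
prefSum R i = ΣV (λ j a → ⌊ toℕ j Data.Nat.≤? toℕ i ⌋ ∧ bar R j a)
  where import Data.Nat

totalSum : ∀ {k} → Adj (suc k) → VecF2 (suc k)
totalSum R = ΣV (bar R)

-- On the coordinates of the path s₁,…,sₙ₋₁ one has \overline{i+1} = s̃ᵢ + s̃ᵢ₊₁
-- (reading s̃ₙ as 0 there): flipping sᵢ adds the sᵢ-coordinate of the current
-- vector, which is 1, to the two path neighbours sᵢ₋₁ and sᵢ₊₁ of sᵢ.  So on the
-- path the sums telescope, to s̃ᵢ and to 0.  The sₙ-coordinate of ī is ⟨ ī , s̃ₙ ⟩,
-- so there a (prefix) sum is the parity of the number of its terms lying in Π₁.
module Submission where

open import Defs
open import Data.Nat using (ℕ; suc; _≤_; _%_)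
open import Data.Fin using (Fin; inject₁)
open import Data.Product using (_×_)
open import Relation.Binary.PropositionalEquality using (_≡_)

open import Algebra.Bundles using (CommutativeRing)
import Algebra.Properties.CommutativeSemigroup as CommutativeSemigroupProperties
open import Data.Bool using (Bool; true; false; not; _∧_; _∨_; _xor_)
open import Data.Bool.Properties
  using (T-≡; xor-identityʳ; xor-assoc; xor-comm; ∧-comm; ∧-assoc; ∧-zeroʳ; ∧-identityʳ;
         ∧-distribˡ-xor; xor-∧-commutativeRing)
open import Data.Fin using (zero; suc; toℕ; fromℕ; fromℕ<)
import Data.Fin.Properties as Fin
open import Data.Nat using (zero; _<_; _≡ᵇ_; _≤ᵇ_; s≤s)
import Data.Nat.Properties as ℕ
open import Data.Product using (_,_; proj₁; proj₂)
open import Data.Sum using (map₁)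
open import Function using (_∘_)
open import Function.Bundles using (_⇔_; mk⇔; Equivalence)
open import Relation.Nullary using (Dec; yes; no)
open import Relation.Binary.PropositionalEquality using (_≢_; refl; sym; trans; cong; cong₂; module ≡-Reasoning)
open import Relation.Nullary.Decidable using (⌊_⌋; T?; isYes≗does; does-⇔; dec-true; dec-false; _⊎-dec_)

open CommutativeSemigroupProperties
  (CommutativeRing.+-commutativeSemigroup xor-∧-commutativeRing) using (interchange)

xor-∨-disjoint : ∀ x y z → y ∧ z ≡ false → (x xor y) xor (y ∨ z) ≡ x xor z
xor-∨-disjoint x false z _  = cong (_xor z) (xor-identityʳ x)
xor-∨-disjoint x true false _ = xor-assoc x true true
xor-∨-disjoint x true true  ()

≡ᵇ-refl : ∀ n → (n ≡ᵇ n) ≡ true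
≡ᵇ-refl n = dec-true (n ℕ.≟ n) refl

suc-≡ᵇ : ∀ n → (suc n ≡ᵇ n) ≡ false
suc-≡ᵇ n = dec-false (suc n ℕ.≟ n) ℕ.1+n≢n

suc-≡ᵇ-disjoint : ∀ m n → ((suc m ≡ᵇ n) ∧ (m ≡ᵇ suc n)) ≡ false
suc-≡ᵇ-disjoint zero    zero    = refl
suc-≡ᵇ-disjoint zero    (suc n) = ∧-zeroʳ _
suc-≡ᵇ-disjoint (suc m) zero    = refl
suc-≡ᵇ-disjoint (suc m) (suc n) = suc-≡ᵇ-disjoint m n

≤ᵇ-xor-suc≤ᵇ : ∀ m n → ((m ≤ᵇ n) xor (suc m ≤ᵇ n)) ≡ (m ≡ᵇ n)
≤ᵇ-xor-suc≤ᵇ zero          zero    = refl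
≤ᵇ-xor-suc≤ᵇ zero          (suc n) = refl
≤ᵇ-xor-suc≤ᵇ (suc m)       zero    = refl
≤ᵇ-xor-suc≤ᵇ (suc zero)    (suc n) = ≤ᵇ-xor-suc≤ᵇ zero n
≤ᵇ-xor-suc≤ᵇ (suc (suc m)) (suc n) = ≤ᵇ-xor-suc≤ᵇ (suc m) n

suc-%2 : ∀ n → (suc n % 2 ≡ᵇ 1) ≡ not (n % 2 ≡ᵇ 1)
suc-%2 zero          = refl
suc-%2 (suc zero)    = refl
suc-%2 (suc (suc n)) = suc-%2 n

-- ⌊_⌋ (isYes) does not compute through map′, unlike does; hence the detour.
⌊⌋-⇔ : ∀ {a b} {A : Set a} {B : Set b} → A ⇔ B → (a? : Dec A) (b? : Dec B) → ⌊ a? ⌋ ≡ ⌊ b? ⌋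
⌊⌋-⇔ A⇔B a? b? = trans (isYes≗does a?) (trans (does-⇔ A⇔B a? b?) (sym (isYes≗does b?)))

≟-sym : ∀ {n} (a b : Fin n) → ⌊ a Fin.≟ b ⌋ ≡ ⌊ b Fin.≟ a ⌋
≟-sym a b = ⌊⌋-⇔ (mk⇔ sym sym) (a Fin.≟ b) (b Fin.≟ a)

chi-toℕ : ∀ {n} (s a : Fin n) → chi s a ≡ (toℕ a ≡ᵇ toℕ s)
chi-toℕ s a = trans (⌊⌋-⇔ (mk⇔ (cong toℕ) Fin.toℕ-injective) (a Fin.≟ s) (toℕ a ℕ.≟ toℕ s))
                    (isYes≗does (toℕ a ℕ.≟ toℕ s))

chi-self : ∀ {n} (s : Fin n) → chi s s ≡ true
chi-self s = trans (isYes≗does (s Fin.≟ s)) (dec-true (s Fin.≟ s) refl)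

chi-≢ : ∀ {n} {s a : Fin n} → a ≢ s → chi s a ≡ false
chi-≢ {s = s} {a} a≢s = trans (isYes≗does (a Fin.≟ s)) (dec-false (a Fin.≟ s) a≢s)

ΣF2-cong : ∀ {n} {f g : Fin n → Bool} → (∀ i → f i ≡ g i) → ΣF2 f ≡ ΣF2 g
ΣF2-cong {zero}  f≗g = refl
ΣF2-cong {suc n} f≗g = cong₂ _xor_ (f≗g zero) (ΣF2-cong (f≗g ∘ suc))

ΣF2-xor : ∀ {n} (f g : Fin n → Bool) → ΣF2 (λ i → f i xor g i) ≡ ΣF2 f xor ΣF2 g
ΣF2-xor {zero}  f g = refl
ΣF2-xor {suc n} f g = trans (cong ((f zero xor g zero) xor_) (ΣF2-xor (f ∘ suc) (g ∘ suc)))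
                            (interchange (f zero) (g zero) _ _)

ΣF2-false : ∀ n → ΣF2 {n} (λ _ → false) ≡ false
ΣF2-false zero    = refl
ΣF2-false (suc n) = ΣF2-false n

ΣF2-δ : ∀ {n} (a : Fin n) (u : Fin n → Bool) → ΣF2 (λ b → ⌊ a Fin.≟ b ⌋ ∧ u b) ≡ u a
ΣF2-δ {suc n} zero    u = trans (cong (u zero xor_) (ΣF2-false n)) (xor-identityʳ (u zero))
ΣF2-δ {suc n} (suc a) u =
  trans (ΣF2-cong (λ b → cong (_∧ u (suc b)) (⌊⌋-⇔ (mk⇔ Fin.suc-injective (cong suc)) _ _)))
        (ΣF2-δ a (λ b → u (suc b)))

ΣF2-δᴺ : ∀ {c m} (h : ℕ → Bool) → c < m → ΣF2 {m} (λ j → (c ≡ᵇ toℕ j) ∧ h (toℕ j)) ≡ h c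
ΣF2-δᴺ {zero}  {suc m} h _         = trans (cong (h 0 xor_) (ΣF2-false m)) (xor-identityʳ (h 0))
ΣF2-δᴺ {suc c} {suc m} h (s≤s c<m) = ΣF2-δᴺ (h ∘ suc) c<m

ΣF2-δᴺ-pair : ∀ {c m} (h : ℕ → Bool) → suc c < m →
  ΣF2 {m} (λ j → h (toℕ j) ∧ ((c ≡ᵇ toℕ j) xor (suc c ≡ᵇ toℕ j))) ≡ h c xor h (suc c)
ΣF2-δᴺ-pair {c} {m} h sc<m = begin
  ΣF2 (λ j → h (toℕ j) ∧ (δ c j xor δ (suc c) j))
    ≡⟨ ΣF2-cong (λ j → distrib (h (toℕ j)) (δ c j) (δ (suc c) j)) ⟩
  ΣF2 (λ j → (δ c j ∧ h (toℕ j)) xor (δ (suc c) j ∧ h (toℕ j)))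
    ≡⟨ ΣF2-xor (λ j → δ c j ∧ h (toℕ j)) (λ j → δ (suc c) j ∧ h (toℕ j)) ⟩
  ΣF2 (λ j → δ c j ∧ h (toℕ j)) xor ΣF2 (λ j → δ (suc c) j ∧ h (toℕ j))
    ≡⟨ cong₂ _xor_ (ΣF2-δᴺ h (ℕ.<-trans (ℕ.n<1+n c) sc<m)) (ΣF2-δᴺ h sc<m) ⟩
  h c xor h (suc c) ∎
  where
  open ≡-Reasoning
  δ : ℕ → Fin m → Bool
  δ c j = c ≡ᵇ toℕ j
  distrib : ∀ x y z → x ∧ (y xor z) ≡ (y ∧ x) xor (z ∧ x)
  distrib x y z = trans (∧-distribˡ-xor x y z) (cong₂ _xor_ (∧-comm x y) (∧-comm x z))

ΣF2-count : ∀ {n} (f : Fin n → Bool) → ΣF2 f ≡ (count f % 2 ≡ᵇ 1)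
ΣF2-count {zero}  f = refl
ΣF2-count {suc n} f with f zero
... | true  = trans (cong not (ΣF2-count (f ∘ suc))) (sym (suc-%2 (count (f ∘ suc))))
... | false = ΣF2-count (f ∘ suc)

dot-chi : ∀ {n} (u : VecF2 n) (s : Fin n) → ⟨ u , chi s ⟩ ≡ u s
dot-chi u s = trans (ΣF2-cong (λ b → trans (∧-comm (u b) _) (cong (_∧ u b) (≟-sym b s)))) (ΣF2-δ s u)

≋-by-last-and-path : ∀ {k} {u v : VecF2 (suc k)} →
  u (fromℕ k) ≡ v (fromℕ k) → (∀ a → u (inject₁ a) ≡ v (inject₁ a)) → u ≋ v
≋-by-last-and-path {zero}  last _    zero    = last
≋-by-last-and-path {suc k} _    path zero    = path zero
≋-by-last-and-path {suc k} last path (suc a) = ≋-by-last-and-path {k} last (λ b → path (suc b)) a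

flipMat-· : ∀ {n} (R : Adj n) → (∀ a → R a a ≡ false) → ∀ s (w : VecF2 n) a →
  (flipMat R s · w) a ≡ w a xor (R a s ∧ w s)
flipMat-· R loopless s w a = begin
  ΣF2 (λ b → flipMat R s a b ∧ w b)
    ≡⟨ ΣF2-cong entry ⟩
  ΣF2 (λ b → (⌊ a Fin.≟ b ⌋ ∧ w b) xor (⌊ s Fin.≟ b ⌋ ∧ (R a b ∧ w b)))
    ≡⟨ ΣF2-xor (λ b → ⌊ a Fin.≟ b ⌋ ∧ w b) (λ b → ⌊ s Fin.≟ b ⌋ ∧ (R a b ∧ w b)) ⟩
  ΣF2 (λ b → ⌊ a Fin.≟ b ⌋ ∧ w b) xor ΣF2 (λ b → ⌊ s Fin.≟ b ⌋ ∧ (R a b ∧ w b))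
    ≡⟨ cong₂ _xor_ (ΣF2-δ a w) (ΣF2-δ s (λ b → R a b ∧ w b)) ⟩
  w a xor (R a s ∧ w s) ∎
  where
  open ≡-Reasoning
  entry : ∀ b → flipMat R s a b ∧ w b ≡ (⌊ a Fin.≟ b ⌋ ∧ w b) xor (⌊ s Fin.≟ b ⌋ ∧ (R a b ∧ w b))
  entry b with a Fin.≟ b
  ... | yes refl rewrite loopless a = sym (trans (cong (w a xor_) (∧-zeroʳ _)) (xor-identityʳ (w a)))
  ... | no _ = trans (∧-assoc _ (R a b) (w b)) (cong (_∧ (R a b ∧ w b)) (≟-sym b s))

module PathSums {k : ℕ} (R : Adj (suc k)) (loopless : ∀ a → R a a ≡ false) (path : InducedPath R) where

  path-adjacency : ∀ (a s : Fin k) →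
    R (inject₁ a) (inject₁ s) ≡ (suc (toℕ a) ≡ᵇ toℕ s) ∨ (toℕ a ≡ᵇ suc (toℕ s))
  path-adjacency a s = does-⇔
    (mk⇔ (map₁ sym ∘ proj₁ (path a s) ∘ Equivalence.to T-≡)
         (Equivalence.from T-≡ ∘ proj₂ (path a s) ∘ map₁ sym))
    (T? (R (inject₁ a) (inject₁ s)))
    ((suc (toℕ a) ℕ.≟ toℕ s) ⊎-dec (toℕ a ℕ.≟ suc (toℕ s)))

  flips-path : ∀ j (p : j ≤ k) (a : Fin k) →
    flips R j p (chi zero) (inject₁ a) ≡ (toℕ a ≡ᵇ j) xor (suc (toℕ a) ≡ᵇ j)
  flips-path zero p a = begin
    chi zero (inject₁ a)          ≡⟨ chi-toℕ zero (inject₁ a) ⟩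
    (toℕ (inject₁ a) ≡ᵇ 0)        ≡⟨ cong (_≡ᵇ 0) (Fin.toℕ-inject₁ a) ⟩
    (toℕ a ≡ᵇ 0)                  ≡⟨ xor-identityʳ (toℕ a ≡ᵇ 0) ⟨
    (toℕ a ≡ᵇ 0) xor false        ∎
    where open ≡-Reasoning
  flips-path (suc j) p a = begin
    (flipMat R (inject₁ s) · w) (inject₁ a)
      ≡⟨ flipMat-· R loopless (inject₁ s) w (inject₁ a) ⟩
    w (inject₁ a) xor (R (inject₁ a) (inject₁ s) ∧ w (inject₁ s))
      ≡⟨ cong₂ (λ u r → u xor (r ∧ w (inject₁ s))) (flips-path j p′ a) adjacent ⟩
    (x xor y) xor ((y ∨ z) ∧ w (inject₁ s))
      ≡⟨ cong (λ v → (x xor y) xor ((y ∨ z) ∧ v)) pivot ⟩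
    (x xor y) xor ((y ∨ z) ∧ true)
      ≡⟨ cong ((x xor y) xor_) (∧-identityʳ (y ∨ z)) ⟩
    (x xor y) xor (y ∨ z)
      ≡⟨ xor-∨-disjoint x y z (suc-≡ᵇ-disjoint (toℕ a) j) ⟩
    x xor z
      ≡⟨ xor-comm x z ⟩
    z xor x ∎
    where
    open ≡-Reasoning
    s = fromℕ< p
    -- the bound used by the definition of flips
    p′ = ℕ.≤-pred (ℕ.≤-trans (ℕ.n≤1+n (suc j)) (s≤s p))
    w = flips R j p′ (chi zero)
    x = toℕ a ≡ᵇ j
    y = suc (toℕ a) ≡ᵇ j
    z = toℕ a ≡ᵇ suc j
    toℕ-s : toℕ s ≡ j
    toℕ-s = Fin.toℕ-fromℕ< p
    adjacent : R (inject₁ a) (inject₁ s) ≡ y ∨ z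
    adjacent = trans (path-adjacency a s) (cong (λ t → (suc (toℕ a) ≡ᵇ t) ∨ (toℕ a ≡ᵇ suc t)) toℕ-s)
    pivot : w (inject₁ s) ≡ true
    pivot = begin
      w (inject₁ s)                        ≡⟨ flips-path j p′ s ⟩
      (toℕ s ≡ᵇ j) xor (suc (toℕ s) ≡ᵇ j)  ≡⟨ cong (λ t → (t ≡ᵇ j) xor (suc t ≡ᵇ j)) toℕ-s ⟩
      (j ≡ᵇ j) xor (suc j ≡ᵇ j)            ≡⟨ cong₂ _xor_ (≡ᵇ-refl j) (suc-≡ᵇ j) ⟩
      true                                 ∎

  bar-path : ∀ (j : Fin (suc k)) (a : Fin k) →
    bar R j (inject₁ a) ≡ (toℕ a ≡ᵇ toℕ j) xor (suc (toℕ a) ≡ᵇ toℕ j)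
  bar-path j a = flips-path (toℕ j) _ a

  prefSum-path : ∀ (i a : Fin k) → prefSum R (inject₁ i) (inject₁ a) ≡ chi (inject₁ i) (inject₁ a)
  prefSum-path i a = begin
    ΣF2 {suc k} (λ j → ⌊ toℕ j ℕ.≤? I ⌋ ∧ bar R j (inject₁ a))
      ≡⟨ ΣF2-cong (λ j → cong₂ _∧_ (isYes≗does (toℕ j ℕ.≤? I)) (bar-path j a)) ⟩
    ΣF2 {suc k} (λ j → (toℕ j ≤ᵇ I) ∧ ((toℕ a ≡ᵇ toℕ j) xor (suc (toℕ a) ≡ᵇ toℕ j)))
      ≡⟨ ΣF2-δᴺ-pair (_≤ᵇ I) (s≤s (Fin.toℕ<n a)) ⟩
    (toℕ a ≤ᵇ I) xor (suc (toℕ a) ≤ᵇ I)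
      ≡⟨ ≤ᵇ-xor-suc≤ᵇ (toℕ a) I ⟩
    (toℕ a ≡ᵇ I)
      ≡⟨ cong (_≡ᵇ I) (Fin.toℕ-inject₁ a) ⟨
    (toℕ (inject₁ a) ≡ᵇ I)
      ≡⟨ chi-toℕ (inject₁ i) (inject₁ a) ⟨
    chi (inject₁ i) (inject₁ a) ∎
    where
    open ≡-Reasoning
    I = toℕ (inject₁ i)

  totalSum-path : ∀ (a : Fin k) → totalSum R (inject₁ a) ≡ false
  totalSum-path a = trans (ΣF2-cong (λ j → bar-path j a)) (ΣF2-δᴺ-pair (λ _ → true) (s≤s (Fin.toℕ<n a)))

  prefSum-last : ∀ (i : Fin (suc k)) → prefSum R i (fromℕ k) ≡ (countPrefΠ₁ R i % 2 ≡ᵇ 1)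
  prefSum-last i = trans (ΣF2-cong (λ j → cong (⌊ toℕ j ℕ.≤? toℕ i ⌋ ∧_) (sym (dot-chi (bar R j) (fromℕ k)))))
                         (ΣF2-count (λ j → ⌊ toℕ j ℕ.≤? toℕ i ⌋ ∧ inΠ₁ R j))

  totalSum-last : totalSum R (fromℕ k) ≡ (countΠ₁ R % 2 ≡ᵇ 1)
  totalSum-last = trans (ΣF2-cong (λ j → sym (dot-chi (bar R j) (fromℕ k)))) (ΣF2-count (inΠ₁ R))

lemma3p3 : (k : ℕ) → 1 ≤ k → (R : Adj (suc k)) →
    Simple R → Connected R → InducedPath R →
    ((i : Fin k) →
      (countPrefΠ₁ R (inject₁ i) % 2 ≡ 1 → prefSum R (inject₁ i) ≋ (chi (inject₁ i) ⊕ chi (lastV k))) ×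
      (countPrefΠ₁ R (inject₁ i) % 2 ≡ 0 → prefSum R (inject₁ i) ≋ chi (inject₁ i)))
    ×
    ((countΠ₁ R % 2 ≡ 1 → totalSum R ≋ chi (lastV k)) ×
     (countΠ₁ R % 2 ≡ 0 → totalSum R ≋ zeroV))
lemma3p3 k _ R (_ , loopless) _ path = (λ i → oddPrefix i , evenPrefix i) , (oddTotal , evenTotal)
  where
  open PathSums R loopless path

  chi-fromℕ-inject₁ : ∀ (a : Fin k) → chi (fromℕ k) (inject₁ a) ≡ false
  chi-fromℕ-inject₁ a = chi-≢ (Fin.fromℕ≢inject₁ ∘ sym)

  chi-inject₁-fromℕ : ∀ (i : Fin k) → chi (inject₁ i) (fromℕ k) ≡ false
  chi-inject₁-fromℕ i = chi-≢ Fin.fromℕ≢inject₁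

  oddPrefix : ∀ i → countPrefΠ₁ R (inject₁ i) % 2 ≡ 1 →
    prefSum R (inject₁ i) ≋ (chi (inject₁ i) ⊕ chi (lastV k))
  oddPrefix i odd = ≋-by-last-and-path
    (trans (prefSum-last (inject₁ i))
      (trans (cong (_≡ᵇ 1) odd) (sym (cong₂ _xor_ (chi-inject₁-fromℕ i) (chi-self (fromℕ k))))))
    (λ a → trans (prefSum-path i a)
      (sym (trans (cong (chi (inject₁ i) (inject₁ a) xor_) (chi-fromℕ-inject₁ a)) (xor-identityʳ _))))

  evenPrefix : ∀ i → countPrefΠ₁ R (inject₁ i) % 2 ≡ 0 → prefSum R (inject₁ i) ≋ chi (inject₁ i)
  evenPrefix i even = ≋-by-last-and-path
    (trans (prefSum-last (inject₁ i)) (trans (cong (_≡ᵇ 1) even) (sym (chi-inject₁-fromℕ i))))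
    (prefSum-path i)

  oddTotal : countΠ₁ R % 2 ≡ 1 → totalSum R ≋ chi (lastV k)
  oddTotal odd = ≋-by-last-and-path
    (trans totalSum-last (trans (cong (_≡ᵇ 1) odd) (sym (chi-self (fromℕ k)))))
    (λ a → trans (totalSum-path a) (sym (chi-fromℕ-inject₁ a)))

  evenTotal : countΠ₁ R % 2 ≡ 0 → totalSum R ≋ zeroV
  evenTotal even = ≋-by-last-and-path (trans totalSum-last (cong (_≡ᵇ 1) even)) totalSum-path
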